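{- Fix $m,i,j\in\mathbb{Z}$ and $\lambda\in\mathscr{P}^*_{m,j}$, let $\mu:=p^*_{m,j}(\lambda)$, assume $\mu\in\mathscr{P}_{m-1,i}$, and let $\nu:=p_{m-1,i}(\mu)$. Then: (a) if $i<j$, then $\nu\subseteq\lambda$, the skew diagram $\lambda\setminus\nu$ is a border strip, $\#(\lambda\setminus\nu)=j-i$, and $\operatorname{height}(\lambda\setminus\nu)=\operatorname{count}_{m-1}(i,\mu)-\operatorname{count}_m(j,\lambda)$; (b) if $i>j$, then $\lambda\subseteq\nu$, the skew diagram $\nu\setminus\lambda$ is a border strip, $\#(\nu\setminus\lambda)=i-j$, and $\operatorname{height}(\nu\setminus\lambda)=\operatorname{count}_m(j,\lambda)-\operatorname{count}_{m-1}(i,\mu)$; (c) if $i=j$, then $\nu=\lambda$.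
   Context: $\mathscr{P}$ is the set of partitions $\lambda=(\lambda_1,\lambda_2,\dots)$ (weakly decreasing, nonnegative integers, finitely many nonzero). The Young diagram of $\lambda$ is $\{(r,c)\in\mathbb{Z}^2: 1\le c\le\lambda_r\}$ (first coordinate the row). For $\nu\subseteq\lambda$ (i.e. $\nu_k\le\lambda_k$ for all $k$) the skew diagram $\lambda\setminus\nu$ is the set difference of Young diagrams, $\#$ its number of boxes; it is a border strip if it is nonempty, connected (boxes sharing a side) and contains no $2\times2$ block; its height is one less than the number of rows it occupies. For $m,i\in\mathbb{Z}$ and $\lambda\in\mathscr{P}$: $\operatorname{count}_m(i,\lambda):=\#\{k:\lambda_k>i-m+k-1\}$; $\mathscr{P}_{m,i}:=\{\lambda:\lambda_k\ne i-m+k-1\text{ for all }k\}$; $\mathscr{P}^*_{m,i}:=\{\lambda:\lambda_k=i-m+k-1\text{ for some }k\}$. For $\lambda\in\mathscr{P}_{m,i}$, with $c=\operatorname{count}_m(i,\lambda)$, $p_{m,i}(\lambda)=\mu$ where $\mu_k=\lambda_k-1$ for $k\le c$, $\mu_{c+1}=i-m+c-1$, and $\mu_k=\lambda_{k-1}$ for $k>c+1$. For $\lambda\in\mathscr{P}^*_{m,i}$, with $c=\operatorname{count}_m(i,\lambda)$, $p^*_{m,i}(\lambda)=\mu$ where $\mu_k=\lambda_k+1$ for $k\le c$ and $\mu_k=\lambda_{k+1}$ for $k>c$. -}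

module Defs where

open import Data.Nat as ℕ using (ℕ; zero; suc; _+_; _∸_; _≤_; _<_)
open import Data.Integer as ℤ using (ℤ; +_; ∣_∣)
open import Data.List using (List; []; _∷_; length; map; filter; upTo)
open import Data.Nat.ListAction using (sum)
open import Data.Product using (_×_; _,_; ∃; ∃-syntax)
open import Data.Sum using (_⊎_)
open import Data.Bool using (true; false)
open import Relation.Binary.PropositionalEquality using (_≡_; _≢_)
open import Relation.Nullary using (¬_)

-- A partition is represented by a finite list of its parts; trailing zeros are
-- allowed and every notion below only depends on the infinite sequence
-- (at la 0 , at la 1 , ...) which is the paper's (λ_1 , λ_2 , ...).
-- INDEXING CONVENTION: row indices are 0-based, i.e. at la k = λ_{k+1}.
at : List ℕ → ℕ → ℕ
at []       _       = 0
at (x ∷ xs) zero    = x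
at (x ∷ xs) (suc k) = at xs k

-- weakly decreasing (finitely many nonzero parts is automatic for lists)
IsPartition : List ℕ → Set
IsPartition la = ∀ k → at la (suc k) ≤ at la k

-- the paper's threshold i - m + k - 1 at paper index k, written at 0-based index k
thr : ℤ → ℤ → ℕ → ℤ
thr m i k = i ℤ.- m ℤ.+ + k

-- count_m(i,λ) = #{k : λ_k > i-m+k-1}.  All such (0-based) k are below
-- length la + ∣ m - i ∣ (beyond that, λ_k = 0 ≤ i-m+k-1), so counting
-- in this range counts the whole set.
count : ℤ → ℤ → List ℕ → ℕ
count m i la =
  length (filter (λ k → thr m i k ℤ.<? + at la k) (upTo (length la + ∣ m ℤ.- i ∣)))

InP : ℤ → ℤ → List ℕ → Set
InP m i la = ∀ k → + at la k ≢ thr m i k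

InP* : ℤ → ℤ → List ℕ → Set
InP* m i la = ∃[ k ] (+ at la k ≡ thr m i k)

-- p_{m,i}: μ_k = λ_k - 1 (k ≤ c), μ_{c+1} = i-m+c-1, μ_k = λ_{k-1} (k > c+1)
-- (0-based: index < c, index = c, index > c).  The value i-m+c-1 is
-- nonnegative whenever la is a partition in 𝒫_{m,i}.
pEntry : ℤ → ℤ → List ℕ → ℕ → ℕ → ℕ
pEntry m i la c k with k ℕ.<ᵇ c | k ℕ.≡ᵇ c
... | true  | _               = at la k ∸ 1
... | false | true  = ∣ i ℤ.- m ℤ.+ + c ℤ.- + 1 ∣
... | false | false = at la (k ∸ 1)

p : ℤ → ℤ → List ℕ → List ℕ
p m i la = map (pEntry m i la (count m i la)) (upTo (count m i la + length la + 1))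

p*Entry : List ℕ → ℕ → ℕ → ℕ
p*Entry la c k with k ℕ.<ᵇ c
... | true  = suc (at la k)
... | false = at la (suc k)

p* : ℤ → ℤ → List ℕ → List ℕ
p* m i la = map (p*Entry la (count m i la)) (upTo (count m i la + length la))

_⊆ₚ_ : List ℕ → List ℕ → Set
nu ⊆ₚ la = ∀ k → at nu k ≤ at la k

-- boxes (row r, column c), both 0-based, of the skew diagram la ∖ nu
InSkew : List ℕ → List ℕ → ℕ × ℕ → Set
InSkew la nu (r , c) = (at nu r ≤ c) × (c < at la r)

Adj : ℕ × ℕ → ℕ × ℕ → Set
Adj (r , c) (r' , c') =
  ((r ≡ r') × ((suc c ≡ c') ⊎ (c ≡ suc c'))) ⊎ ((c ≡ c') × ((suc r ≡ r') ⊎ (r ≡ suc r')))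

data Path (S : ℕ × ℕ → Set) (a : ℕ × ℕ) : ℕ × ℕ → Set where
  here : S a → Path S a a
  step : ∀ {b c} → Path S a b → Adj b c → S c → Path S a c

Connected : (ℕ × ℕ → Set) → Set
Connected S = ∀ a b → S a → S b → Path S a b

No2×2 : (ℕ × ℕ → Set) → Set
No2×2 S = ∀ r c → ¬ (S (r , c) × S (suc r , c) × S (r , suc c) × S (suc r , suc c))

IsBorderStrip : (ℕ × ℕ → Set) → Set
IsBorderStrip S = (∃[ a ] S a) × Connected S × No2×2 S

-- #(la ∖ nu): number of boxes = sum of the row lengths (for nu ⊆ la)
size : List ℕ → List ℕ → ℕ
size la nu = sum (map (λ r → at la r ∸ at nu r) (upTo (length la)))

-- number of rows occupied by la ∖ nu (rows r with ν_r < λ_r; all below length la)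
rowsOcc : List ℕ → List ℕ → ℕ
rowsOcc la nu = length (filter (λ r → at nu r ℕ.<? at la r) (upTo (length la)))

height : List ℕ → List ℕ → ℕ
height la nu = rowsOcc la nu ∸ 1

module Submission where

-- Let c = count_m(j,λ), where λ meets the line k ↦ j-m+k (so λ_c = j-m+c), and
-- c′ = count_{m-1}(i,μ), so that ν_{c′} = i-m+c′.  Outside the rows between c and c′
-- the two maps cancel and ν agrees with λ; i ≤ j forces c ≤ c′ and j ≤ i forces
-- c′ ≤ c.  On the band between them one of λ, ν is the other moved one row and one
-- column (ν_r = λ_{r+1} - 1, resp. ν_{r+1} = λ_r + 1), so consecutive rows of the skew
-- shape share exactly one column: it is a border strip whose height is the band
-- length, and whose size telescopes to (j-m+c) + (c′-c) - (i-m+c′) = j - i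
-- (resp. symmetrically).

open import Defs
open import Data.Nat as ℕ using (ℕ; zero; suc; _+_; _∸_; _≤_; _<_; _⊓_; z≤n; s≤s)
import Data.Nat.Properties as ℕP
open import Data.Integer as ℤ using (ℤ; +_; -[1+_]; ∣_∣; 0ℤ; 1ℤ; -_; _-_) renaming (suc to sucℤ)
import Data.Integer.Properties as ℤP
open import Data.Integer.Tactic.RingSolver using (solve-∀)
open import Data.List using (List; []; _∷_; _++_; [_]; length; map; filter; upTo; applyUpTo)
import Data.List.Properties as ListP
open import Data.List.Relation.Unary.All as All using (All)
open import Data.List.Relation.Unary.All.Properties using (applyUpTo⁺₁; applyUpTo⁺₂)
open import Data.Nat.ListAction using (sum)
open import Data.Nat.ListAction.Properties using (sum-++)
open import Data.Bool using (true; false)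
open import Data.Product using (_×_; _,_; proj₁; proj₂; ∃-syntax)
open import Data.Sum using (inj₁; inj₂)
open import Data.Empty using (⊥-elim)
open import Function using (_∘_; id)
open import Relation.Binary.PropositionalEquality
  using (_≡_; _≢_; refl; sym; trans; cong; cong₂; subst; subst₂; module ≡-Reasoning)
open import Relation.Binary.Definitions using (tri<; tri≈; tri>)
open import Relation.Nullary using (¬_; yes; no)
open import Relation.Unary using (Decidable)

at-≥length : ∀ xs {k} → length xs ≤ k → at xs k ≡ 0
at-≥length []       _        = refl
at-≥length (x ∷ xs) (s≤s le) = at-≥length xs le

at>0⇒<length : ∀ xs {k} → 0 < at xs k → k < length xs
at>0⇒<length xs pos = ℕP.≰⇒> (λ le → ℕP.<⇒≢ pos (sym (at-≥length xs le)))

at-map-applyUpTo : ∀ (f g : ℕ → ℕ) n {k} → k < n → at (map f (applyUpTo g n)) k ≡ f (g k)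
at-map-applyUpTo f g (suc n) {zero}  _        = refl
at-map-applyUpTo f g (suc n) {suc k} (s≤s lt) = at-map-applyUpTo f (g ∘ suc) n lt

at-map-upTo : ∀ (f : ℕ → ℕ) n → (∀ k → n ≤ k → f k ≡ 0) → ∀ k → at (map f (upTo n)) k ≡ f k
at-map-upTo f n vanish k with k ℕ.<? n
... | yes k<n = at-map-applyUpTo f id n k<n
... | no  k≮n = trans (at-≥length (map f (upTo n)) (subst (_≤ k) (sym length≡n) n≤k)) (sym (vanish k n≤k))
  where
  n≤k = ℕP.≮⇒≥ k≮n
  length≡n : length (map f (upTo n)) ≡ n
  length≡n = trans (ListP.length-map f (upTo n)) (ListP.length-upTo n)

applyUpTo-+ : ∀ {A : Set} (h : ℕ → A) a n →
  applyUpTo h (a + n) ≡ applyUpTo h a ++ applyUpTo (λ d → h (a + d)) n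
applyUpTo-+ h zero    n = refl
applyUpTo-+ h (suc a) n = cong (h 0 ∷_) (applyUpTo-+ (h ∘ suc) a n)

upTo-split : ∀ {a b n} → a ≤ b → b < n →
  ∃[ xs ] ∃[ zs ] (upTo n ≡ xs ++ applyUpTo (λ d → a + d) (suc (b ∸ a)) ++ zs) × All (_< a) xs × All (b <_) zs
upTo-split {a} {b} {n} a≤b b<n =
  upTo a , applyUpTo (λ e → a + (suc D + e)) t , split , applyUpTo⁺₁ id a (λ r<a → r<a) , applyUpTo⁺₂ _ t b<tail
  where
  open ≡-Reasoning
  D = b ∸ a
  t = n ∸ suc b
  a+1+D≡1+b : a + suc D ≡ suc b
  a+1+D≡1+b = trans (ℕP.+-suc a D) (cong suc (ℕP.m+[n∸m]≡n a≤b))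
  split : upTo n ≡ upTo a ++ applyUpTo (λ d → a + d) (suc D) ++ applyUpTo (λ e → a + (suc D + e)) t
  split = begin
    upTo n                                   ≡⟨ cong upTo (sym (trans (sym (ℕP.+-assoc a (suc D) t))
                                                  (trans (cong (_+ t) a+1+D≡1+b) (ℕP.m+[n∸m]≡n b<n)))) ⟩
    upTo (a + (suc D + t))                   ≡⟨ applyUpTo-+ id a (suc D + t) ⟩
    upTo a ++ applyUpTo (λ d → a + d) (suc D + t)   ≡⟨ cong (upTo a ++_) (applyUpTo-+ (λ d → a + d) (suc D) t) ⟩
    upTo a ++ applyUpTo (λ d → a + d) (suc D) ++ applyUpTo (λ e → a + (suc D + e)) t ∎
  b<tail : ∀ e → b < a + (suc D + e)
  b<tail e = subst (_≤ a + (suc D + e)) a+1+D≡1+b (ℕP.+-monoʳ-≤ a (ℕP.m≤m+n (suc D) e))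

sum-map-++ : ∀ (f : ℕ → ℕ) xs ys → sum (map f (xs ++ ys)) ≡ sum (map f xs) + sum (map f ys)
sum-map-++ f xs ys = trans (cong sum (ListP.map-++ f xs ys)) (sum-++ (map f xs) (map f ys))

sum-map-zero : ∀ {f : ℕ → ℕ} {xs} → All (λ x → f x ≡ 0) xs → sum (map f xs) ≡ 0
sum-map-zero All.[]             = refl
sum-map-zero (fx≡0 All.∷ f≡0s) = cong₂ _+_ fx≡0 (sum-map-zero f≡0s)

sum-applyUpTo-suc : ∀ (h : ℕ → ℕ) n → sum (applyUpTo h (suc n)) ≡ sum (applyUpTo h n) + h n
sum-applyUpTo-suc h n = begin
  sum (applyUpTo h (suc n))         ≡⟨ cong sum (sym (ListP.applyUpTo-∷ʳ h n)) ⟩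
  sum (applyUpTo h n ++ [ h n ])    ≡⟨ sum-++ (applyUpTo h n) [ h n ] ⟩
  sum (applyUpTo h n) + (h n + 0)   ≡⟨ cong (λ z → sum (applyUpTo h n) + z) (ℕP.+-identityʳ (h n)) ⟩
  sum (applyUpTo h n) + h n         ∎
  where open ≡-Reasoning

length-filter-++ : ∀ {P : ℕ → Set} (P? : Decidable P) xs ys →
  length (filter P? (xs ++ ys)) ≡ length (filter P? xs) + length (filter P? ys)
length-filter-++ P? xs ys = trans (cong length (ListP.filter-++ P? xs ys)) (ListP.length-++ (filter P? xs))

DownClosed : (ℕ → Set) → Set
DownClosed P = ∀ k → P (suc k) → P k

Threshold : (ℕ → Set) → ℕ → Set
Threshold P c = (∀ k → k < c → P k) × (∀ k → c ≤ k → ¬ P k)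

downClosed-≤ : ∀ {P} → DownClosed P → ∀ {j k} → j ≤ k → P k → P j
downClosed-≤ down {k = zero}  z≤n Pk = Pk
downClosed-≤ {P} down {k = suc k} le Pk with ℕP.m≤n⇒m<n∨m≡n le
... | inj₁ (s≤s j≤k) = downClosed-≤ {P} down j≤k (down k Pk)
... | inj₂ refl      = Pk

partition-antitone : ∀ la → IsPartition la → ∀ {k k′} → k ≤ k′ → at la k′ ≤ at la k
partition-antitone la part {k′ = k′} k≤k′ =
  downClosed-≤ {λ j → at la k′ ≤ at la j} (λ j q → ℕP.≤-trans q (part j)) k≤k′ ℕP.≤-refl

threshold-< : ∀ {P c k} → Threshold P c → P k → k < c
threshold-< (_ , ¬P≥c) Pk = ℕP.≰⇒> (λ c≤k → ¬P≥c _ c≤k Pk)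

threshold-unique : ∀ {P c c′} → Threshold P c → Threshold P c′ → c ≡ c′
threshold-unique {c = c} {c′} th th′ with ℕP.<-cmp c c′
... | tri< c<c′ _ _ = ⊥-elim (ℕP.<-irrefl refl (threshold-< th (proj₁ th′ c c<c′)))
... | tri≈ _ c≡c′ _ = c≡c′
... | tri> _ _ c′<c = ⊥-elim (ℕP.<-irrefl refl (threshold-< th′ (proj₁ th c′ c′<c)))

threshold-exists : ∀ {P} → Decidable P → DownClosed P → ∀ n → ¬ P n → ∃[ c ] c ≤ n × Threshold P c
threshold-exists {P} P? down zero ¬P0 =
  0 , z≤n , (λ _ ()) , (λ k _ Pk → ¬P0 (downClosed-≤ {P} down z≤n Pk))
threshold-exists {P} P? down (suc n) ¬P1+n with P? n
... | yes Pn = suc n , ℕP.≤-refl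
             , (λ k k<1+n → downClosed-≤ {P} down (ℕP.≤-pred k<1+n) Pn)
             , (λ k 1+n≤k Pk → ¬P1+n (downClosed-≤ {P} down 1+n≤k Pk))
... | no ¬Pn with threshold-exists P? down n ¬Pn
...   | c , c≤n , th = c , ℕP.m≤n⇒m≤1+n c≤n , th

length-filter-upTo : ∀ {P c} (P? : Decidable P) → Threshold P c → ∀ n → length (filter P? (upTo n)) ≡ c ⊓ n
length-filter-upTo {c = c} P? th zero    = sym (ℕP.⊓-zeroʳ c)
length-filter-upTo {P} {c} P? th (suc n) = begin
  length (filter P? (upTo (suc n)))                       ≡⟨ cong (length ∘ filter P?) (sym (ListP.upTo-∷ʳ n)) ⟩
  length (filter P? (upTo n ++ [ n ]))                    ≡⟨ length-filter-++ P? (upTo n) [ n ] ⟩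
  length (filter P? (upTo n)) + length (filter P? [ n ])  ≡⟨ cong (λ z → z + length (filter P? [ n ])) (length-filter-upTo P? th n) ⟩
  c ⊓ n + length (filter P? [ n ])                        ≡⟨ last-row ⟩
  c ⊓ suc n                                               ∎
  where
  open ≡-Reasoning
  last-row : c ⊓ n + length (filter P? [ n ]) ≡ c ⊓ suc n
  last-row with n ℕ.<? c
  ... | yes n<c = begin
    c ⊓ n + length (filter P? [ n ]) ≡⟨ cong₂ _+_ (ℕP.m≥n⇒m⊓n≡n (ℕP.<⇒≤ n<c)) (cong length (ListP.filter-accept P? (proj₁ th n n<c))) ⟩
    n + 1                            ≡⟨ ℕP.+-comm n 1 ⟩
    suc n                            ≡⟨ sym (ℕP.m≥n⇒m⊓n≡n n<c) ⟩
    c ⊓ suc n                        ∎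
  ... | no n≮c = begin
    c ⊓ n + length (filter P? [ n ]) ≡⟨ cong₂ _+_ (ℕP.m≤n⇒m⊓n≡m c≤n) (cong length (ListP.filter-reject P? (proj₂ th n c≤n))) ⟩
    c + 0                            ≡⟨ ℕP.+-identityʳ c ⟩
    c                                ≡⟨ sym (ℕP.m≤n⇒m⊓n≡m (ℕP.m≤n⇒m≤1+n c≤n)) ⟩
    c ⊓ suc n                        ∎
    where c≤n = ℕP.≮⇒≥ n≮c

thr-suc : ∀ m i k → thr m i (suc k) ≡ sucℤ (thr m i k)
thr-suc m i k = shift (i - m) (+ k)
  where
  shift : ∀ x K → x ℤ.+ (1ℤ ℤ.+ K) ≡ 1ℤ ℤ.+ (x ℤ.+ K)
  shift = solve-∀

thr-pred-m : ∀ m i k → thr (m - 1ℤ) i k ≡ thr m i (suc k)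
thr-pred-m m i k = shift i m (+ k)
  where
  shift : ∀ i m K → i - (m - 1ℤ) ℤ.+ K ≡ i - m ℤ.+ (1ℤ ℤ.+ K)
  shift = solve-∀

thr-monoʳ-< : ∀ m i {k k′} → k < k′ → thr m i k ℤ.< thr m i k′
thr-monoʳ-< m i k<k′ = ℤP.+-monoʳ-< (i - m) (ℤ.+<+ k<k′)

thr-monoʳ-≤ : ∀ m i {k k′} → k ≤ k′ → thr m i k ℤ.≤ thr m i k′
thr-monoʳ-≤ m i k≤k′ = ℤP.+-monoʳ-≤ (i - m) (ℤ.+≤+ k≤k′)

thr-monoˡ-≤ : ∀ m {i j} k → i ℤ.≤ j → thr m i k ℤ.≤ thr m j k
thr-monoˡ-≤ m k i≤j = ℤP.+-monoˡ-≤ (+ k) (ℤP.+-monoˡ-≤ (- m) i≤j)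

thr-monoˡ-< : ∀ m {i j} k → i ℤ.< j → thr m i k ℤ.< thr m j k
thr-monoˡ-< m k i<j = ℤP.+-monoˡ-< (+ k) (ℤP.+-monoˡ-< (- m) i<j)

thr-nonneg : ∀ m i n → 0ℤ ℤ.≤ thr m i (n + ∣ m - i ∣)
thr-nonneg m i n = begin
  0ℤ                          ≤⟨ 0≤-x+∣x∣ (m - i) ⟩
  - (m - i) ℤ.+ + ∣ m - i ∣   ≡⟨ cong (λ z → z ℤ.+ + ∣ m - i ∣) (neg-sub m i) ⟩
  i - m ℤ.+ + ∣ m - i ∣       ≤⟨ ℤP.+-monoʳ-≤ (i - m) (ℤ.+≤+ (ℕP.m≤n+m ∣ m - i ∣ n)) ⟩
  thr m i (n + ∣ m - i ∣)     ∎
  where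
  open ℤP.≤-Reasoning
  0≤-x+∣x∣ : ∀ x → 0ℤ ℤ.≤ - x ℤ.+ + ∣ x ∣
  0≤-x+∣x∣ (+ n)    = ℤP.≤-reflexive (sym (ℤP.+-inverseˡ (+ n)))
  0≤-x+∣x∣ -[1+ n ] = ℤ.+≤+ z≤n
  neg-sub : ∀ m i → - (m - i) ≡ i - m
  neg-sub = solve-∀

<suc⇒≤ : ∀ {x y} → x ℤ.< sucℤ y → x ℤ.≤ y
<suc⇒≤ x<1+y = ℤP.≮⇒≥ (λ y<x → ℤP.<⇒≱ x<1+y (ℤP.i<j⇒suc[i]≤j y<x))

Below : ℤ → ℤ → List ℕ → ℕ → Set
Below m i la k = thr m i k ℤ.< + at la k

Below? : ∀ m i la → Decidable (Below m i la)
Below? m i la k = thr m i k ℤ.<? + at la k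

count-threshold : ∀ m i la → IsPartition la → Threshold (Below m i la) (count m i la)
count-threshold m i la part = counted (threshold-exists (Below? m i la) down N ¬Below-N)
  where
  N = length la + ∣ m - i ∣
  down : DownClosed (Below m i la)
  down k below = ℤP.<-trans (thr-monoʳ-< m i (ℕP.n<1+n k)) (ℤP.<-≤-trans below (ℤ.+≤+ (part k)))
  ¬Below-N : ¬ Below m i la N
  ¬Below-N below = ℤP.<⇒≱ (subst (λ z → thr m i N ℤ.< + z) (at-≥length la (ℕP.m≤m+n _ _)) below)
                          (thr-nonneg m i (length la))
  counted : ∃[ c ] c ≤ N × Threshold (Below m i la) c → Threshold (Below m i la) (count m i la)
  counted (c , c≤N , th) = subst (Threshold (Below m i la))
    (sym (trans (length-filter-upTo (Below? m i la) th N) (ℕP.m≤n⇒m⊓n≡m c≤N))) th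

count-at-hit : ∀ m i la {k₀} → IsPartition la → + at la k₀ ≡ thr m i k₀ → count m i la ≡ k₀
count-at-hit m i la {k₀} part hit = threshold-unique (count-threshold m i la part) (above , below)
  where
  open ℤP.≤-Reasoning
  above : ∀ k → k < k₀ → Below m i la k
  above k k<k₀ = begin-strict
    thr m i k    <⟨ thr-monoʳ-< m i k<k₀ ⟩
    thr m i k₀   ≡⟨ sym hit ⟩
    + at la k₀   ≤⟨ ℤ.+≤+ (partition-antitone la part (ℕP.<⇒≤ k<k₀)) ⟩
    + at la k    ∎
  below : ∀ k → k₀ ≤ k → ¬ Below m i la k
  below k k₀≤k lt = ℤP.<⇒≱ lt (begin
    + at la k    ≤⟨ ℤ.+≤+ (partition-antitone la part k₀≤k) ⟩
    + at la k₀   ≡⟨ hit ⟩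
    thr m i k₀   ≤⟨ thr-monoʳ-≤ m i k₀≤k ⟩
    thr m i k    ∎)

module _ (la : List ℕ) {c k : ℕ} where

  p*Entry-< : k < c → p*Entry la c k ≡ suc (at la k)
  p*Entry-< k<c with k ℕ.<ᵇ c | ℕP.<⇒<ᵇ k<c
  ... | true | _ = refl

  p*Entry-≥ : c ≤ k → p*Entry la c k ≡ at la (suc k)
  p*Entry-≥ c≤k with k ℕ.<ᵇ c | ℕP.<ᵇ⇒< k c
  ... | false | _   = refl
  ... | true  | k<c = ⊥-elim (ℕP.≤⇒≯ c≤k (k<c _))

  pEntry-< : ∀ m i → k < c → pEntry m i la c k ≡ at la k ∸ 1
  pEntry-< m i k<c with k ℕ.<ᵇ c | ℕP.<⇒<ᵇ k<c
  ... | true | _ = refl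

  pEntry-> : ∀ m i → c < k → pEntry m i la c k ≡ at la (k ∸ 1)
  pEntry-> m i c<k with k ℕ.<ᵇ c | ℕP.<ᵇ⇒< k c | k ℕ.≡ᵇ c | ℕP.≡ᵇ⇒≡ k c
  ... | false | _   | false | _   = refl
  ... | true  | k<c | _     | _   = ⊥-elim (ℕP.<-asym c<k (k<c _))
  ... | false | _   | true  | k≡c = ⊥-elim (ℕP.<-irrefl (sym (k≡c _)) c<k)

pEntry-≡ : ∀ m i la c → pEntry m i la c c ≡ ∣ i - m ℤ.+ + c - + 1 ∣
pEntry-≡ m i la c with c ℕ.<ᵇ c | ℕP.<ᵇ⇒< c c | c ℕ.≡ᵇ c | ℕP.≡⇒≡ᵇ c c refl
... | false | _   | true | _ = refl
... | true  | c<c | _    | _ = ⊥-elim (ℕP.<-irrefl refl (c<c _))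

at-p* : ∀ m i la k → at (p* m i la) k ≡ p*Entry la (count m i la) k
at-p* m i la = at-map-upTo (p*Entry la c) (c + length la) vanish
  where
  c = count m i la
  vanish : ∀ k → c + length la ≤ k → p*Entry la c k ≡ 0
  vanish k le = trans (p*Entry-≥ la (ℕP.≤-trans (ℕP.m≤m+n c _) le))
                      (at-≥length la (ℕP.m≤n⇒m≤1+n (ℕP.≤-trans (ℕP.m≤n+m _ c) le)))

at-p : ∀ m i la k → at (p m i la) k ≡ pEntry m i la (count m i la) k
at-p m i la = at-map-upTo (pEntry m i la c) (c + length la + 1) vanish
  where
  c = count m i la
  vanish : ∀ k → c + length la + 1 ≤ k → pEntry m i la c k ≡ 0
  vanish k le = trans (pEntry-> la m i c<k) (at-≥length la (ℕP.≤-trans (ℕP.m≤n+m _ c) (ℕP.∸-monoˡ-≤ 1 le′)))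
    where
    le′ : suc (c + length la) ≤ k
    le′ = subst (_≤ k) (ℕP.+-comm (c + length la) 1) le
    c<k : c < k
    c<k = ℕP.<-≤-trans (s≤s (ℕP.m≤m+n c _)) le′

Adj-sym : ∀ {x y} → Adj x y → Adj y x
Adj-sym (inj₁ (r≡ , inj₁ c≡)) = inj₁ (sym r≡ , inj₂ (sym c≡))
Adj-sym (inj₁ (r≡ , inj₂ c≡)) = inj₁ (sym r≡ , inj₁ (sym c≡))
Adj-sym (inj₂ (c≡ , inj₁ r≡)) = inj₂ (sym c≡ , inj₂ (sym r≡))
Adj-sym (inj₂ (c≡ , inj₂ r≡)) = inj₂ (sym c≡ , inj₁ (sym r≡))

module _ {S : ℕ × ℕ → Set} where

  path-target : ∀ {x y} → Path S x y → S y
  path-target (here s)     = s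
  path-target (step _ _ s) = s

  path-++ : ∀ {x y z} → Path S x y → Path S y z → Path S x z
  path-++ p (here _)       = p
  path-++ p (step q adj s) = step (path-++ p q) adj s

  path-reverse : ∀ {x y} → Path S x y → Path S y x
  path-reverse (here s)       = here s
  path-reverse (step p adj s) = path-++ (step (here s) (Adj-sym adj) (path-target p)) (path-reverse p)

module BorderStrip (lo hi : List ℕ) (a b : ℕ) (a≤b : a ≤ b)
  (below   : ∀ r → r < a → at lo r ≡ at hi r)
  (above   : ∀ r → b < r → at lo r ≡ at hi r)
  (inside  : ∀ r → a ≤ r → r ≤ b → at lo r < at hi r)
  (shared  : ∀ r → a ≤ r → r < b → suc (at lo r) ≡ at hi (suc r))
  where

  S : ℕ × ℕ → Set
  S = InSkew hi lo

  locate : ∀ {r x} → S (r , x) → a ≤ r × r ≤ b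
  locate {r} {x} (lo≤x , x<hi) = ℕP.≮⇒≥ (λ r<a → empty (below r r<a)) , ℕP.≮⇒≥ (λ b<r → empty (above r b<r))
    where
    empty : at lo r ≢ at hi r
    empty lo≡hi = ℕP.<-irrefl refl (ℕP.<-≤-trans x<hi (subst (_≤ x) lo≡hi lo≤x))

  ⊆ : lo ⊆ₚ hi
  ⊆ r with r ℕ.<? a | b ℕ.<? r
  ... | yes r<a | _       = ℕP.≤-reflexive (below r r<a)
  ... | no _    | yes b<r = ℕP.≤-reflexive (above r b<r)
  ... | no r≮a  | no b≮r  = ℕP.<⇒≤ (inside r (ℕP.≮⇒≥ r≮a) (ℕP.≮⇒≥ b≮r))

  horizontal : ∀ {r x} y → at lo r ≤ x → x ≤ y → y < at hi r → Path S (r , x) (r , y)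
  horizontal zero    lo≤x z≤n   y<hi = here (lo≤x , y<hi)
  horizontal (suc y) lo≤x x≤1+y y<hi with ℕP.m≤n⇒m<n∨m≡n x≤1+y
  ... | inj₁ (s≤s x≤y) =
    step (horizontal y lo≤x x≤y (ℕP.<-trans (ℕP.n<1+n y) y<hi)) (inj₁ (refl , inj₁ refl))
         (ℕP.≤-trans lo≤x (ℕP.≤-trans x≤y (ℕP.n≤1+n y)) , y<hi)
  ... | inj₂ refl = here (lo≤x , y<hi)

  -- each row is entered from the row above through the shared column at lo r
  rowStart : ∀ r → a ≤ r → r ≤ b → Path S (a , at lo a) (r , at lo r)
  rowStart r a≤r r≤b with ℕP.m≤n⇒m<n∨m≡n a≤r
  ... | inj₂ refl = here (ℕP.≤-refl , inside r ℕP.≤-refl r≤b)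
  ... | inj₁ (s≤s {n = r′} a≤r′) =
    path-++ (step (rowStart r′ a≤r′ (ℕP.<⇒≤ r′<b)) (inj₂ (refl , inj₁ refl)) (lo≤ , lo<hi))
            (path-reverse (horizontal (at lo r′) ℕP.≤-refl lo≤ lo<hi))
    where
    r′<b : r′ < b
    r′<b = r≤b
    share : suc (at lo r′) ≡ at hi r
    share = shared r′ a≤r′ r′<b
    lo<hi : at lo r′ < at hi r
    lo<hi = ℕP.≤-reflexive share
    lo≤ : at lo r ≤ at lo r′
    lo≤ = ℕP.≤-pred (subst (at lo r <_) (sym share) (inside r (ℕP.m≤n⇒m≤1+n a≤r′) r≤b))

  fromBase : ∀ {r y} → S (r , y) → Path S (a , at lo a) (r , y)
  fromBase {r} {y} s@(lo≤y , y<hi) =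
    path-++ (rowStart r (proj₁ (locate s)) (proj₂ (locate s))) (horizontal y ℕP.≤-refl lo≤y y<hi)

  connected : Connected S
  connected _ _ s s′ = path-++ (path-reverse (fromBase s)) (fromBase s′)

  no2×2 : No2×2 S
  no2×2 r x (s@(lo≤x , _) , s′ , _ , (_ , x<hi)) = ℕP.<-irrefl refl (ℕP.<-≤-trans x<lo lo≤x)
    where
    x<lo : x < at lo r
    x<lo = ℕP.≤-pred (subst (suc x <_) (sym (shared r (proj₁ (locate s)) (proj₂ (locate s′)))) x<hi)

  isBorderStrip : IsBorderStrip S
  isBorderStrip = ((a , at lo a) , ℕP.≤-refl , inside a ℕP.≤-refl a≤b) , connected , no2×2

  width : ℕ → ℕ
  width r = at hi r ∸ at lo r

  Occupied? : Decidable (λ r → at lo r < at hi r)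
  Occupied? r = at lo r ℕ.<? at hi r

  b<length : b < length hi
  b<length = at>0⇒<length hi (ℕP.≤-<-trans z≤n (inside b a≤b ℕP.≤-refl))

  a+[b∸a]≡b : a + (b ∸ a) ≡ b
  a+[b∸a]≡b = ℕP.m+[n∸m]≡n a≤b

  inside-offset : ∀ {d} → d < suc (b ∸ a) → at lo (a + d) < at hi (a + d)
  inside-offset {d} d≤b∸a = inside (a + d) (ℕP.m≤m+n a d)
    (subst (a + d ≤_) a+[b∸a]≡b (ℕP.+-monoʳ-≤ a (ℕP.≤-pred d≤b∸a)))

  width+lo : ∀ {r} → a ≤ r → r ≤ b → width r + at lo r ≡ at hi r
  width+lo a≤r r≤b = ℕP.m∸n+n≡m (ℕP.<⇒≤ (inside _ a≤r r≤b))

  bandWidth : ℕ → ℕ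
  bandWidth d = width (a + d)

  telescope : ∀ d → a + d ≤ b → sum (applyUpTo bandWidth (suc d)) + at lo (a + d) ≡ at hi a + d
  telescope zero a+0≤b = begin
    sum (applyUpTo bandWidth 1) + at lo (a + 0)   ≡⟨ cong (_+ at lo (a + 0)) (sum-applyUpTo-suc bandWidth 0) ⟩
    width (a + 0) + at lo (a + 0)                 ≡⟨ width+lo (ℕP.m≤m+n a 0) a+0≤b ⟩
    at hi (a + 0)                                 ≡⟨ cong (at hi) (ℕP.+-identityʳ a) ⟩
    at hi a                                       ≡⟨ sym (ℕP.+-identityʳ (at hi a)) ⟩
    at hi a + 0                                   ∎
    where open ≡-Reasoning
  telescope (suc d) a+1+d≤b = begin
    sum (applyUpTo bandWidth (suc (suc d))) + at lo (a + suc d)  ≡⟨ cong (_+ at lo (a + suc d)) (sum-applyUpTo-suc bandWidth (suc d)) ⟩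
    Σ + width (a + suc d) + at lo (a + suc d)                    ≡⟨ ℕP.+-assoc Σ _ _ ⟩
    Σ + (width (a + suc d) + at lo (a + suc d))                  ≡⟨ cong (_+_ Σ) (width+lo (ℕP.m≤m+n a (suc d)) a+1+d≤b) ⟩
    Σ + at hi (a + suc d)                                        ≡⟨ cong (_+_ Σ) (sym share) ⟩
    Σ + suc (at lo (a + d))                                      ≡⟨ ℕP.+-suc Σ _ ⟩
    suc (Σ + at lo (a + d))                                      ≡⟨ cong suc (telescope d (ℕP.<⇒≤ a+d<b)) ⟩
    suc (at hi a + d)                                            ≡⟨ sym (ℕP.+-suc (at hi a) d) ⟩
    at hi a + suc d                                              ∎
    where
    open ≡-Reasoning
    Σ = sum (applyUpTo bandWidth (suc d))
    a+d<b : a + d < b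
    a+d<b = subst (_≤ b) (ℕP.+-suc a d) a+1+d≤b
    share : suc (at lo (a + d)) ≡ at hi (a + suc d)
    share = trans (shared (a + d) (ℕP.m≤m+n a d) a+d<b) (cong (at hi) (sym (ℕP.+-suc a d)))

  telescope-band : sum (applyUpTo bandWidth (suc (b ∸ a))) + at lo b ≡ at hi a + (b ∸ a)
  telescope-band = subst (λ z → sum (applyUpTo bandWidth (suc (b ∸ a))) + at lo z ≡ at hi a + (b ∸ a))
                         a+[b∸a]≡b (telescope (b ∸ a) (ℕP.≤-reflexive a+[b∸a]≡b))

  size≡ : size hi lo + at lo b ≡ at hi a + (b ∸ a)
  size≡ with upTo-split a≤b b<length
  ... | xs , zs , upTo≡ , xs<a , b<zs = begin
    size hi lo + at lo b                                              ≡⟨ cong (λ rs → sum (map width rs) + at lo b) upTo≡ ⟩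
    sum (map width (xs ++ middle ++ zs)) + at lo b                    ≡⟨ cong (_+ at lo b) blocks ⟩
    sum (map width middle) + at lo b                                  ≡⟨ cong (λ rs → sum rs + at lo b) (ListP.map-applyUpTo (λ d → a + d) width (suc (b ∸ a))) ⟩
    sum (applyUpTo bandWidth (suc (b ∸ a))) + at lo b                 ≡⟨ telescope-band ⟩
    at hi a + (b ∸ a)                                                 ∎
    where
    open ≡-Reasoning
    middle = applyUpTo (λ d → a + d) (suc (b ∸ a))
    flat : ∀ {r} → at lo r ≡ at hi r → width r ≡ 0
    flat {r} lo≡hi = trans (cong (at hi r ∸_) lo≡hi) (ℕP.n∸n≡0 (at hi r))
    blocks : sum (map width (xs ++ middle ++ zs)) ≡ sum (map width middle)
    blocks = begin
      sum (map width (xs ++ middle ++ zs))                                    ≡⟨ sum-map-++ width xs _ ⟩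
      sum (map width xs) + sum (map width (middle ++ zs))                     ≡⟨ cong₂ _+_ (sum-map-zero (All.map (flat ∘ below _) xs<a)) (sum-map-++ width middle zs) ⟩
      sum (map width middle) + sum (map width zs)                             ≡⟨ cong (_+_ (sum (map width middle))) (sum-map-zero (All.map (flat ∘ above _) b<zs)) ⟩
      sum (map width middle) + 0                                              ≡⟨ ℕP.+-identityʳ _ ⟩
      sum (map width middle)                                                  ∎

  rowsOcc≡ : rowsOcc hi lo ≡ suc (b ∸ a)
  rowsOcc≡ with upTo-split a≤b b<length
  ... | xs , zs , upTo≡ , xs<a , b<zs = begin
    rowsOcc hi lo                                                              ≡⟨ cong (length ∘ filter Occupied?) upTo≡ ⟩
    length (filter Occupied? (xs ++ middle ++ zs))                             ≡⟨ length-filter-++ Occupied? xs _ ⟩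
    length (filter Occupied? xs) + length (filter Occupied? (middle ++ zs))    ≡⟨ cong₂ _+_ (empty (All.map (equal ∘ below _) xs<a)) (length-filter-++ Occupied? middle zs) ⟩
    length (filter Occupied? middle) + length (filter Occupied? zs)            ≡⟨ cong₂ _+_ full (empty (All.map (equal ∘ above _) b<zs)) ⟩
    suc (b ∸ a) + 0                                                            ≡⟨ ℕP.+-identityʳ _ ⟩
    suc (b ∸ a)                                                                ∎
    where
    open ≡-Reasoning
    middle = applyUpTo (λ d → a + d) (suc (b ∸ a))
    equal : ∀ {r} → at lo r ≡ at hi r → ¬ (at lo r < at hi r)
    equal lo≡hi = ℕP.<-irrefl lo≡hi
    empty : ∀ {rs} → All (λ r → ¬ (at lo r < at hi r)) rs → length (filter Occupied? rs) ≡ 0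
    empty none = cong length (ListP.filter-none Occupied? none)
    full : length (filter Occupied? middle) ≡ suc (b ∸ a)
    full = trans (cong length (ListP.filter-all Occupied? (applyUpTo⁺₁ (λ d → a + d) (suc (b ∸ a)) inside-offset)))
                 (ListP.length-applyUpTo (λ d → a + d) (suc (b ∸ a)))

  height≡ : height hi lo ≡ b ∸ a
  height≡ = cong (_∸ 1) rowsOcc≡

suc[n∸1]≡n : ∀ {n} → 0 < n → suc (n ∸ 1) ≡ n
suc[n∸1]≡n {suc n} _ = refl

pos-∸ : ∀ {a b} → a ≤ b → + (b ∸ a) ≡ + b - + a
pos-∸ {a} {b} a≤b = trans (sym (ℤP.⊖-≥ a≤b)) (sym (ℤP.m-n≡m⊖n b a))

skew-size : ∀ m i j {a b s x y} → a ≤ b → s + x ≡ y + (b ∸ a) →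
  + x ≡ thr m i b → + y ≡ thr m j a → + s ≡ j - i
skew-size m i j {a} {b} {s} {x} {y} a≤b s+x≡ x≡ y≡ = begin
  + s                                      ≡⟨ add-sub (+ s) (+ x) ⟩
  + s ℤ.+ + x - + x                        ≡⟨ cong₂ _-_ lift x≡ ⟩
  thr m j a ℤ.+ (+ b - + a) - thr m i b    ≡⟨ difference i j m (+ a) (+ b) ⟩
  j - i                                    ∎
  where
  open ≡-Reasoning
  add-sub : ∀ S X → S ≡ S ℤ.+ X - X
  add-sub = solve-∀
  difference : ∀ i j m A B → j - m ℤ.+ A ℤ.+ (B - A) - (i - m ℤ.+ B) ≡ j - i
  difference = solve-∀
  lift : + s ℤ.+ + x ≡ thr m j a ℤ.+ (+ b - + a)
  lift = begin
    + s ℤ.+ + x              ≡⟨ sym (ℤP.pos-+ s x) ⟩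
    + (s + x)                ≡⟨ cong +_ s+x≡ ⟩
    + (y + (b ∸ a))          ≡⟨ ℤP.pos-+ y (b ∸ a) ⟩
    + y ℤ.+ + (b ∸ a)        ≡⟨ cong₂ ℤ._+_ y≡ (pos-∸ a≤b) ⟩
    thr m j a ℤ.+ (+ b - + a) ∎

module Composite (m i j : ℤ) (la : List ℕ) (la-partition : IsPartition la)
                 (k₀ : ℕ) (la-hit : + at la k₀ ≡ thr m j k₀)
                 (μ-avoids : InP (m - 1ℤ) i (p* m j la)) where

  c : ℕ
  c = count m j la

  μ : List ℕ
  μ = p* m j la

  la-at-c : + at la c ≡ thr m j c
  la-at-c = subst (λ z → + at la z ≡ thr m j z) (sym (count-at-hit m j la la-partition la-hit)) la-hit

  la-above : ∀ {k} → k < c → thr m j k ℤ.< + at la k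
  la-above = proj₁ (count-threshold m j la la-partition) _

  μ-< : ∀ {k} → k < c → at μ k ≡ suc (at la k)
  μ-< {k} k<c = trans (at-p* m j la k) (p*Entry-< la k<c)

  μ-≥ : ∀ {k} → c ≤ k → at μ k ≡ at la (suc k)
  μ-≥ {k} c≤k = trans (at-p* m j la k) (p*Entry-≥ la c≤k)

  μ-partition : IsPartition μ
  μ-partition k with suc k ℕ.<? c | k ℕ.<? c
  ... | yes k+1<c | _ = subst₂ _≤_ (sym (μ-< k+1<c)) (sym (μ-< (ℕP.<-trans (ℕP.n<1+n k) k+1<c)))
                          (s≤s (la-partition k))
  ... | no k+1≮c | yes k<c = subst₂ _≤_ (sym (μ-≥ (ℕP.≮⇒≥ k+1≮c))) (sym (μ-< k<c))
                               (ℕP.m≤n⇒m≤1+n (partition-antitone la la-partition (ℕP.m≤n⇒m≤1+n (ℕP.n≤1+n k))))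
  ... | no _ | no k≮c = subst₂ _≤_ (sym (μ-≥ (ℕP.m≤n⇒m≤1+n (ℕP.≮⇒≥ k≮c)))) (sym (μ-≥ (ℕP.≮⇒≥ k≮c)))
                          (la-partition (suc k))

  c′ : ℕ
  c′ = count (m - 1ℤ) i μ

  ν : List ℕ
  ν = p (m - 1ℤ) i μ

  μ-threshold : Threshold (Below (m - 1ℤ) i μ) c′
  μ-threshold = count-threshold (m - 1ℤ) i μ μ-partition

  μ-above : ∀ {k} → k < c′ → thr m i (suc k) ℤ.< + at μ k
  μ-above {k} k<c′ = subst (ℤ._< + at μ k) (thr-pred-m m i k) (proj₁ μ-threshold k k<c′)

  -- μ ∈ 𝒫_{m-1,i} is what makes this inequality strict
  μ-below : ∀ {k} → c′ ≤ k → + at μ k ℤ.< thr m i (suc k)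
  μ-below {k} c′≤k = subst (+ at μ k ℤ.<_) (thr-pred-m m i k)
    (ℤP.≤∧≢⇒< (ℤP.≮⇒≥ (proj₂ μ-threshold k c′≤k)) (μ-avoids k))

  thr-at-c′-nonneg : 0ℤ ℤ.≤ thr m i c′
  thr-at-c′-nonneg = ℤP.≤-trans (ℤ.+≤+ z≤n)
    (<suc⇒≤ (subst (+ at μ c′ ℤ.<_) (thr-suc m i c′) (μ-below ℕP.≤-refl)))

  ν-< : ∀ {k} → k < c′ → at ν k ≡ at μ k ∸ 1
  ν-< {k} k<c′ = trans (at-p (m - 1ℤ) i μ k) (pEntry-< μ (m - 1ℤ) i k<c′)

  ν-> : ∀ {k} → c′ < k → at ν k ≡ at μ (k ∸ 1)
  ν-> {k} c′<k = trans (at-p (m - 1ℤ) i μ k) (pEntry-> μ (m - 1ℤ) i c′<k)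

  -- the ∣_∣ in pEntry is harmless here because thr m i c′ is nonnegative
  ν-at-c′ : + at ν c′ ≡ thr m i c′
  ν-at-c′ = begin
    + at ν c′                               ≡⟨ cong +_ (trans (at-p (m - 1ℤ) i μ c′) (pEntry-≡ (m - 1ℤ) i μ c′)) ⟩
    + ∣ i - (m - 1ℤ) ℤ.+ + c′ - + 1 ∣       ≡⟨ cong (λ z → + ∣ z ∣) (unshift i m (+ c′)) ⟩
    + ∣ thr m i c′ ∣                        ≡⟨ ℤP.0≤i⇒+∣i∣≡i thr-at-c′-nonneg ⟩
    thr m i c′                              ∎
    where
    open ≡-Reasoning
    unshift : ∀ i m K → i - (m - 1ℤ) ℤ.+ K - 1ℤ ≡ i - m ℤ.+ K
    unshift = solve-∀

  c≤c′ : i ℤ.≤ j → c ≤ c′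
  c≤c′ i≤j = ℕP.≮⇒≥ (λ c′<c → ℤP.<-asym (μ-below ℕP.≤-refl) (μ-above-thr c′<c))
    where
    open ℤP.≤-Reasoning
    μ-above-thr : ∀ {k} → k < c → thr m i (suc k) ℤ.< + at μ k
    μ-above-thr {k} k<c = begin-strict
      thr m i (suc k)       ≤⟨ thr-monoˡ-≤ m (suc k) i≤j ⟩
      thr m j (suc k)       ≡⟨ thr-suc m j k ⟩
      sucℤ (thr m j k)      ≤⟨ ℤP.i<j⇒suc[i]≤j (la-above k<c) ⟩
      + at la k             <⟨ ℤ.+<+ (ℕP.n<1+n _) ⟩
      + suc (at la k)       ≡⟨ cong +_ (sym (μ-< k<c)) ⟩
      + at μ k              ∎

  c′≤c : j ℤ.≤ i → c′ ≤ c
  c′≤c j≤i = ℕP.≮⇒≥ (λ c<c′ → ℤP.<-asym (μ-above c<c′) μ-c-below)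
    where
    open ℤP.≤-Reasoning
    μ-c-below : + at μ c ℤ.< thr m i (suc c)
    μ-c-below = begin-strict
      + at μ c              ≡⟨ cong +_ (μ-≥ ℕP.≤-refl) ⟩
      + at la (suc c)       ≤⟨ ℤ.+≤+ (la-partition c) ⟩
      + at la c             ≡⟨ la-at-c ⟩
      thr m j c             <⟨ thr-monoʳ-< m j (ℕP.n<1+n c) ⟩
      thr m j (suc c)       ≤⟨ thr-monoˡ-≤ m (suc c) j≤i ⟩
      thr m i (suc c)       ∎

  ν≡la-before : ∀ {k} → k < c → k < c′ → at ν k ≡ at la k
  ν≡la-before k<c k<c′ = trans (ν-< k<c′) (cong (_∸ 1) (μ-< k<c))

  ν≡la-after : ∀ {k} → c < k → c′ < k → at ν k ≡ at la k
  ν≡la-after {suc k} c<k+1 c′<k+1 = trans (ν-> c′<k+1) (μ-≥ (ℕP.≤-pred c<k+1))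

  module Shrinking (i<j : i ℤ.< j) where

    ordered : c ≤ c′
    ordered = c≤c′ (ℤP.<⇒≤ i<j)

    la-strip-above : ∀ {r} → c ≤ r → r < c′ → thr m i (suc r) ℤ.< + at la (suc r)
    la-strip-above {r} c≤r r<c′ = subst (λ z → thr m i (suc r) ℤ.< + z) (μ-≥ c≤r) (μ-above r<c′)

    la-at-c′ : thr m i c′ ℤ.< + at la c′
    la-at-c′ with ℕP.m≤n⇒m<n∨m≡n ordered
    ... | inj₂ c≡c′ = subst (λ z → thr m i z ℤ.< + at la z) c≡c′
                        (subst (thr m i c ℤ.<_) (sym la-at-c) (thr-monoˡ-< m c i<j))
    ... | inj₁ c<c′ = subst (λ z → thr m i z ℤ.< + at la z) c′-1+1
                        (la-strip-above (ℕP.<⇒≤pred c<c′) (ℕP.≤-reflexive c′-1+1))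
      where
      c′-1+1 : suc (c′ ∸ 1) ≡ c′
      c′-1+1 = suc[n∸1]≡n (ℕP.≤-<-trans z≤n c<c′)

    la-pos : ∀ {r} → r ≤ c′ → 0 < at la r
    la-pos r≤c′ = ℕP.<-≤-trans (ℤP.drop‿+<+ (ℤP.≤-<-trans thr-at-c′-nonneg la-at-c′))
                              (partition-antitone la la-partition r≤c′)

    ν-strip : ∀ r → c ≤ r → r < c′ → suc (at ν r) ≡ at la (suc r)
    ν-strip r c≤r r<c′ = trans (cong suc (trans (ν-< r<c′) (cong (_∸ 1) (μ-≥ c≤r)))) (suc[n∸1]≡n (la-pos r<c′))

    ν-inside : ∀ r → c ≤ r → r ≤ c′ → at ν r < at la r
    ν-inside r c≤r r≤c′ with ℕP.m≤n⇒m<n∨m≡n r≤c′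
    ... | inj₁ r<c′ = ℕP.<-≤-trans (ℕP.≤-reflexive (ν-strip r c≤r r<c′)) (la-partition r)
    ... | inj₂ refl = ℤP.drop‿+<+ (subst (ℤ._< + at la r) (sym ν-at-c′) la-at-c′)

    open BorderStrip ν la c c′ ordered
      (λ r r<c → ν≡la-before r<c (ℕP.<-≤-trans r<c ordered))
      (λ r c′<r → ν≡la-after (ℕP.≤-<-trans ordered c′<r) c′<r)
      ν-inside ν-strip

    shrinking : ν ⊆ₚ la × IsBorderStrip (InSkew la ν)
              × + size la ν ≡ j - i × + height la ν ≡ + c′ - + c
    shrinking = ⊆ , isBorderStrip
              , skew-size m i j ordered size≡ ν-at-c′ la-at-c
              , trans (cong +_ height≡) (pos-∸ ordered)

  module Growing (j<i : j ℤ.< i) where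

    ordered : c′ ≤ c
    ordered = c′≤c (ℤP.<⇒≤ j<i)

    la-at-c′ : + at la c′ ℤ.< thr m i c′
    la-at-c′ with ℕP.m≤n⇒m<n∨m≡n ordered
    ... | inj₂ c′≡c = subst (λ z → + at la z ℤ.< thr m i z) (sym c′≡c)
                        (subst (ℤ._< thr m i c) (sym la-at-c) (thr-monoˡ-< m c j<i))
    ... | inj₁ c′<c = ℤP.suc[i]≤j⇒i<j (<suc⇒≤ (subst₂ ℤ._<_ (cong +_ (μ-< c′<c)) (thr-suc m i c′) (μ-below ℕP.≤-refl)))

    ν-strip : ∀ r → c′ ≤ r → r < c → suc (at la r) ≡ at ν (suc r)
    ν-strip r c′≤r r<c = sym (trans (ν-> (s≤s c′≤r)) (μ-< r<c))

    ν-inside : ∀ r → c′ ≤ r → r ≤ c → at la r < at ν r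
    ν-inside r c′≤r r≤c with ℕP.m≤n⇒m<n∨m≡n c′≤r
    ... | inj₂ refl = ℤP.drop‿+<+ (subst (+ at la r ℤ.<_) (sym ν-at-c′) la-at-c′)
    ... | inj₁ (s≤s {n = r′} c′≤r′) = ℕP.≤-<-trans (la-partition r′) (ℕP.≤-reflexive (ν-strip r′ c′≤r′ r≤c))

    open BorderStrip la ν c′ c ordered
      (λ r r<c′ → sym (ν≡la-before (ℕP.<-≤-trans r<c′ ordered) r<c′))
      (λ r c<r → sym (ν≡la-after c<r (ℕP.≤-<-trans ordered c<r)))
      ν-inside ν-strip

    growing : la ⊆ₚ ν × IsBorderStrip (InSkew ν la)
            × + size ν la ≡ i - j × + height ν la ≡ + c - + c′
    growing = ⊆ , isBorderStrip
            , skew-size m j i ordered size≡ la-at-c ν-at-c′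
            , trans (cong +_ height≡) (pos-∸ ordered)

  c≡c′ : i ≡ j → c ≡ c′
  c≡c′ i≡j = ℕP.≤-antisym (c≤c′ (ℤP.≤-reflexive i≡j)) (c′≤c (ℤP.≤-reflexive (sym i≡j)))

  unchanged : i ≡ j → ∀ k → at ν k ≡ at la k
  unchanged i≡j k with ℕP.<-cmp k c′
  ... | tri< k<c′ _ _ = ν≡la-before (subst (k <_) (sym (c≡c′ i≡j)) k<c′) k<c′
  ... | tri> _ _ c′<k = ν≡la-after (subst (_< k) (sym (c≡c′ i≡j)) c′<k) c′<k
  ... | tri≈ _ refl _ = ℤP.+-injective (begin
    + at ν c′   ≡⟨ ν-at-c′ ⟩
    thr m i c′  ≡⟨ cong₂ (λ x y → thr m x y) i≡j (sym (c≡c′ i≡j)) ⟩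
    thr m j c   ≡⟨ sym la-at-c ⟩
    + at la c   ≡⟨ cong (λ z → + at la z) (c≡c′ i≡j) ⟩
    + at la c′  ∎)
    where open ≡-Reasoning

proposition5p4 : (m i j : ℤ) (la : List ℕ) → IsPartition la → InP* m j la →
    InP (m - 1ℤ) i (p* m j la) →
    ((i ℤ.< j → (p (m - 1ℤ) i (p* m j la) ⊆ₚ la)
        × IsBorderStrip (InSkew la (p (m - 1ℤ) i (p* m j la)))
        × (+ size la (p (m - 1ℤ) i (p* m j la)) ≡ j - i)
        × (+ height la (p (m - 1ℤ) i (p* m j la))
            ≡ + count (m - 1ℤ) i (p* m j la) - + count m j la))
    × (j ℤ.< i → (la ⊆ₚ p (m - 1ℤ) i (p* m j la))
        × IsBorderStrip (InSkew (p (m - 1ℤ) i (p* m j la)) la)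
        × (+ size (p (m - 1ℤ) i (p* m j la)) la ≡ i - j)
        × (+ height (p (m - 1ℤ) i (p* m j la)) la
            ≡ + count m j la - + count (m - 1ℤ) i (p* m j la)))
    × (i ≡ j → (k : ℕ) → at (p (m - 1ℤ) i (p* m j la)) k ≡ at la k))
proposition5p4 m i j la la-partition (k₀ , la-hit) μ-avoids =
  Shrinking.shrinking , Growing.growing , unchanged
  where open Composite m i j la la-partition k₀ la-hit μ-avoids
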